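{- Let $G=(V,E)$ be a graph (not necessarily connected) with $n$ vertices, and let $\delta\ge1$ and $1\le k\le\sqrt{\delta n}-1$ be integers. Then Algorithm 2 is a $(4+2/D^*_{k,\delta})$-approximation algorithm for BCMD-$\delta$, i.e., it adds at most $k$ edges, increases every vertex degree by at most $\delta$, and the resulting graph has diameter at most $4D^*_{k,\delta}+2$.
   Context: Graphs are simple, undirected, unweighted; $d_G$ is shortest-path distance. Problem BCMD-$\delta$: given $G$ and integers $k,\delta\ge1$, find a set $M$ of at most $k$ non-edges of $G$ minimizing the diameter of $G'=(V,E\cup M)$ subject to $\deg_{G'}(v)\le\deg_G(v)+\delta$ for all $v$; $D^*_{k,\delta}$ is its optimal value. Algorithm 2: (i) compute $k+1$ (not necessarily distinct) centers $c_1,\dots,c_{k+1}$ by the farthest-first rule: $c_1$ is an arbitrary vertex and, for $2\le i\le k+1$, $c_i$ is a vertex maximizing $d_G(c_i,\{c_1,\dots,c_{i-1}\})$; form clusters by assigning each non-center vertex to a nearest center (ties broken arbitrarily); (ii) let $C_{\max}$ be a largest cluster and $c_{\max}$ its center; (iii) for each center $c_i\ne c_{\max}$, add an edge $(c_i,v)$ for some $v\in C_{\max}$ that is currently incident to fewer than $\delta$ newly added edges. -}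

module Defs where

open import Data.Nat using (ℕ; zero; suc; _+_; _*_; _≤_; _<_)
open import Data.Bool using (Bool; true; false; _∨_; _∧_; if_then_else_)
open import Data.Fin using (Fin; toℕ; _≟_)
open import Data.List using (List; []; _∷_; length; filter; allFin; map)
open import Data.Bool.ListAction using (any)
open import Data.List.Relation.Unary.All using (All)
open import Data.Product using (_×_; _,_; proj₁; proj₂; Σ; ∃; ∃-syntax)
open import Relation.Nullary using (¬_)
open import Relation.Nullary.Decidable using (⌊_⌋)
open import Relation.Binary.PropositionalEquality using (_≡_; _≢_)

record Graph (n : ℕ) : Set where
  field
    adj   : Fin n → Fin n → Bool
    sym   : ∀ u v → adj u v ≡ adj v u
    irref : ∀ v → adj v v ≡ false
open Graph public

countF : ∀ {n} → (Fin n → Bool) → ℕ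
countF {zero}  p = 0
countF {suc n} p = (if p Fin.zero then 1 else 0) + countF {n} (λ x → p (Fin.suc x))

deg : ∀ {n} → (Fin n → Fin n → Bool) → Fin n → ℕ
deg a v = countF (a v)

data Walk {n : ℕ} (a : Fin n → Fin n → Bool) : Fin n → Fin n → ℕ → Set where
  here : ∀ {u} → Walk a u u 0
  step : ∀ {u w v ℓ} → a u w ≡ true → Walk a w v ℓ → Walk a u v (suc ℓ)

-- d(u,v) ≤ t  (with d = ∞ when v is unreachable)
Within : ∀ {n} → (Fin n → Fin n → Bool) → Fin n → Fin n → ℕ → Set
Within a u v t = ∃[ ℓ ] (ℓ ≤ t × Walk a u v ℓ)

-- diam ≤ D  (diameter is ∞ for disconnected graphs)
DiamLe : ∀ {n} → (Fin n → Fin n → Bool) → ℕ → Set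
DiamLe {n} a D = (u v : Fin n) → Within a u v D

edgeIn : ∀ {n} → Fin n → Fin n → List (Fin n × Fin n) → Bool
edgeIn u v M = any (λ p → (⌊ proj₁ p ≟ u ⌋ ∧ ⌊ proj₂ p ≟ v ⌋) ∨ (⌊ proj₁ p ≟ v ⌋ ∧ ⌊ proj₂ p ≟ u ⌋)) M

addEdges : ∀ {n} → Graph n → List (Fin n × Fin n) → Fin n → Fin n → Bool
addEdges G M u v = adj G u v ∨ edgeIn u v M

DegBound : ∀ {n} → Graph n → List (Fin n × Fin n) → ℕ → Set
DegBound {n} G M δ = (v : Fin n) → deg (addEdges G M) v ≤ deg (adj G) v + δ

Feasible : ∀ {n} → Graph n → ℕ → ℕ → List (Fin n × Fin n) → Set
Feasible G k δ M =
  All (λ p → proj₁ p ≢ proj₂ p × adj G (proj₁ p) (proj₂ p) ≡ false) M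
  × length M ≤ k × DegBound G M δ

-- step (i): farthest-first centers c : Fin (k+1) → Fin n  (c₁ = c zero arbitrary);
-- for i ≥ 2, d(c_i, {c_j | j < i}) ≥ d(w, {c_j | j < i}) for all w,
-- phrased with possibly infinite distances: d(c_i,S) ≤ t ⇒ d(w,S) ≤ t.
FarthestFirst : ∀ {n k} → Graph n → (Fin (suc k) → Fin n) → Set
FarthestFirst {n} {k} G c =
  (i : Fin (suc k)) → 1 ≤ toℕ i → (w : Fin n) (t : ℕ) →
  (∃[ j ] (toℕ j < toℕ i × Within (adj G) (c i) (c j) t)) →
  (∃[ j ] (toℕ j < toℕ i × Within (adj G) w (c j) t))

-- clusters: each vertex assigned (index of) a nearest center
-- (for a center vertex this forces assignment to an index carrying itself)
NearestAssign : ∀ {n k} → Graph n → (Fin (suc k) → Fin n) → (Fin n → Fin (suc k)) → Set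
NearestAssign {n} {k} G c a =
  (v : Fin n) (j : Fin (suc k)) (t : ℕ) → Within (adj G) v (c j) t → Within (adj G) v (c (a v)) t

clusterSize : ∀ {n k} → (Fin n → Fin (suc k)) → Fin (suc k) → ℕ
clusterSize a i = countF (λ v → ⌊ a v ≟ i ⌋)

LargestCluster : ∀ {n k} → (Fin n → Fin (suc k)) → Fin (suc k) → Set
LargestCluster {n} {k} a m = (i : Fin (suc k)) → clusterSize a i ≤ clusterSize a m

-- step (iii): for centers c_i ≠ c_max (processed in order i = 1..k+1) add
-- edge (c_i , g i) where g i ∈ C_max.
-- indices whose centre differs from c_max, in increasing order
activeIdx : ∀ {n k} → (Fin (suc k) → Fin n) → Fin (suc k) → List (Fin (suc k))
activeIdx {n} {k} c m = filter (λ i → ¬? (c i ≟ c m)) (allFin (suc k))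
  where open import Relation.Nullary using (¬?)

addedEdges : ∀ {n k} → (Fin (suc k) → Fin n) → Fin (suc k) → (Fin (suc k) → Fin n) →
             List (Fin n × Fin n)
addedEdges c m g = map (λ i → c i , g i) (activeIdx c m)

addedBefore : ∀ {n k} → (Fin (suc k) → Fin n) → Fin (suc k) → (Fin (suc k) → Fin n) →
              Fin (suc k) → List (Fin n × Fin n)
addedBefore c m g i =
  map (λ j → c j , g j) (filter (λ j → toℕ j Data.Nat.<? toℕ i) (activeIdx c m))
  where import Data.Nat

incid : ∀ {n} → Fin n → List (Fin n × Fin n) → ℕ
incid v M = length (filter (λ p → ⌊ proj₁ p ≟ v ⌋ ∨ ⌊ proj₂ p ≟ v ⌋ Data.Bool.≟ true) M)
  where import Data.Bool

ValidChoice : ∀ {n k} → (Fin (suc k) → Fin n) → (Fin n → Fin (suc k)) → Fin (suc k) → ℕ →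
              (Fin (suc k) → Fin n) → Set
ValidChoice {n} {k} c a m δ g =
  (i : Fin (suc k)) → c i ≢ c m →
  a (g i) ≡ m × incid (g i) (addedBefore c m g i) < δ

{-# OPTIONS --safe #-}
-- Let M be an optimal solution, of diameter D. Induction on M shows that among any k + 2 vertices
-- two are within distance D in G: for M = e ∷ M′, the hypothesis for G + e and M′, applied with
-- each vertex left out in turn, gives close pairs of G + e avoiding every vertex, hence two disjoint
-- ones or a triangle. Each such pair is close in G or crosses e, and two walks crossing e in the same
-- direction with distinct endpoints can be recombined into a close pair of G (their four halves
-- have total length at most 2D - 2). Applied to a vertex and the farthest-first centres, this puts
-- every vertex within D of its centre, so every vertex reaches c_max in D + 1 + D steps via the
-- edge added at its centre. Since (k + 1)² ≤ δ n, the largest cluster has at least (k + 1) / δ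
-- vertices, so giving each of them δ consecutive centres is a valid choice; a centre outside
-- C_max gets only one new neighbour, because a repeated centre forces C_max = {c_max}.
module Submission where

open import Defs hiding (sym)
open import Data.Nat using (ℕ; zero; suc; _+_; _*_; _^_; _∸_; _≤_; _<_; z≤n; s≤s; s≤s⁻¹; pred; _≤?_; _<?_; NonZero; >-nonZero)
import Data.Nat as ℕ
open import Data.Nat.Properties hiding (_≟_; suc-injective)
open import Data.Nat.DivMod using (_/_; _%_; m%n≡m∸m/n*n; m%n<n; m/n*n≤m; m<n*o⇒m/o<n)
open import Algebra.Properties.CommutativeSemigroup +-commutativeSemigroup using () renaming (interchange to +-interchange)
open import Data.Bool using (Bool; true; false; _∨_; _∧_; if_then_else_)
import Data.Bool as Bool
open import Data.Bool.Properties using (∨-assoc; ∨-comm; ∨-identityʳ; ∨-zeroʳ)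
open import Data.Fin using (Fin; toℕ; _≟_; punchIn; fromℕ<)
open import Data.Fin.Properties using (punchIn-injective; punchInᵢ≢i; toℕ-injective; toℕ-fromℕ<; toℕ<n; suc-injective)
open import Data.List using (List; []; _∷_; length; filter; allFin; map; tabulate)
open import Data.List.Properties using (length-map)
open import Data.Bool.ListAction using (any)
open import Data.Nat.Solver using (module +-*-Solver)
open import Data.Product using (_×_; _,_; proj₁; proj₂; Σ; ∃₂; ∃-syntax; map₂)
import Data.Vec.Functional as Vector
open import Data.Sum using (_⊎_; inj₁; inj₂)
import Data.Sum as Sum
open import Data.Empty using (⊥-elim)
open import Function using (_∘_; id)
open import Function.Definitions using (Injective)
open import Relation.Nullary using (¬_; Dec; yes; no; ¬?)
open import Relation.Nullary.Decidable using (⌊_⌋)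
open import Relation.Unary using (Pred; Decidable)
open import Relation.Binary using (tri<; tri≈; tri>; DecidableEquality)
open import Relation.Binary.PropositionalEquality using (_≡_; _≢_; refl; sym; trans; cong; cong₂; subst; ≢-sym; module ≡-Reasoning)

module _ {ℓ} {P : Set ℓ} where

  toWitness≡ : (d : Dec P) → ⌊ d ⌋ ≡ true → P
  toWitness≡ (yes p) _ = p

  fromWitness≡ : (d : Dec P) → P → ⌊ d ⌋ ≡ true
  fromWitness≡ (yes _) _ = refl
  fromWitness≡ (no ¬p) p = ⊥-elim (¬p p)

  fromWitnessFalse≡ : (d : Dec P) → ¬ P → ⌊ d ⌋ ≡ false
  fromWitnessFalse≡ (yes p) ¬p = ⊥-elim (¬p p)
  fromWitnessFalse≡ (no _) _ = refl

∧-true : ∀ {a b} → a ∧ b ≡ true → a ≡ true × b ≡ true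
∧-true {true} e = refl , e

∨-true : ∀ {a b} → a ∨ b ≡ true → a ≡ true ⊎ b ≡ true
∨-true {true} _ = inj₁ refl
∨-true {false} e = inj₂ e

∨-trueˡ : ∀ {a} b → a ≡ true → a ∨ b ≡ true
∨-trueˡ b e = cong (_∨ b) e

∨-trueʳ : ∀ a {b} → b ≡ true → a ∨ b ≡ true
∨-trueʳ a e = trans (cong (a ∨_) e) (∨-zeroʳ a)

∧-swap : ∀ a b c → a ∧ (b ∧ c) ≡ b ∧ (a ∧ c)
∧-swap true b c = refl
∧-swap false true c = refl
∧-swap false false c = refl

⌊≟true⌋ : ∀ b → ⌊ b Bool.≟ true ⌋ ≡ b
⌊≟true⌋ true = refl
⌊≟true⌋ false = refl

true≢false : true ≢ false
true≢false ()

-- Counting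

bit : Bool → ℕ
bit b = if b then 1 else 0

countF-cong : ∀ {n} {p q : Fin n → Bool} → (∀ x → p x ≡ q x) → countF p ≡ countF q
countF-cong {zero} e = refl
countF-cong {suc n} e = cong₂ _+_ (cong bit (e Fin.zero)) (countF-cong (e ∘ Fin.suc))

countF-mono : ∀ {n} {p q : Fin n → Bool} → (∀ x → p x ≡ true → q x ≡ true) → countF p ≤ countF q
countF-mono {zero} h = z≤n
countF-mono {suc n} {p} {q} h with p Fin.zero in ep | q Fin.zero in eq
... | true  | true  = s≤s (countF-mono (h ∘ Fin.suc))
... | true  | false = ⊥-elim (true≢false (trans (sym (h Fin.zero ep)) eq))
... | false | true  = m≤n⇒m≤1+n (countF-mono (h ∘ Fin.suc))
... | false | false = countF-mono (h ∘ Fin.suc)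

bit-∨ : ∀ a b → bit (a ∨ b) ≤ bit a + bit b
bit-∨ true b = s≤s z≤n
bit-∨ false b = ≤-refl

countF-∨ : ∀ {n} (p q : Fin n → Bool) → countF (λ x → p x ∨ q x) ≤ countF p + countF q
countF-∨ {zero} p q = z≤n
countF-∨ {suc n} p q = begin
  bit (p Fin.zero ∨ q Fin.zero) + countF (λ x → p (Fin.suc x) ∨ q (Fin.suc x))
    ≤⟨ +-mono-≤ (bit-∨ (p Fin.zero) (q Fin.zero)) (countF-∨ (p ∘ Fin.suc) (q ∘ Fin.suc)) ⟩
  (bit (p Fin.zero) + bit (q Fin.zero)) + (countF (p ∘ Fin.suc) + countF (q ∘ Fin.suc))
    ≡⟨ +-interchange (bit (p Fin.zero)) _ _ _ ⟩
  countF p + countF q ∎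
  where open ≤-Reasoning

countF-none : ∀ {n} {p : Fin n → Bool} → (∀ x → p x ≡ false) → countF p ≡ 0
countF-none {zero} h = refl
countF-none {suc n} {p} h rewrite h Fin.zero = countF-none (h ∘ Fin.suc)

countF-witness : ∀ {n} (p : Fin n → Bool) → 1 ≤ countF p → ∃[ x ] p x ≡ true
countF-witness {suc n} p h with p Fin.zero in e
... | true = Fin.zero , e
... | false with x , px ← countF-witness (p ∘ Fin.suc) h = Fin.suc x , px

countF-pos : ∀ {n} (p : Fin n → Bool) x → p x ≡ true → 1 ≤ countF p
countF-pos p Fin.zero e rewrite e = s≤s z≤n
countF-pos p (Fin.suc x) e = ≤-trans (countF-pos (p ∘ Fin.suc) x e) (m≤n+m _ (bit (p Fin.zero)))

countF-≤1 : ∀ {n} (p : Fin n → Bool) → (∀ x y → p x ≡ true → p y ≡ true → x ≡ y) → countF p ≤ 1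
countF-≤1 {zero} p h = z≤n
countF-≤1 {suc n} p h with p Fin.zero in e
... | true = ≤-reflexive (cong suc (countF-none rest-false))
  where
  rest-false : ∀ x → p (Fin.suc x) ≡ false
  rest-false x with p (Fin.suc x) in e′
  ... | true with () ← h Fin.zero (Fin.suc x) e e′
  ... | false = refl
... | false = countF-≤1 (p ∘ Fin.suc) λ x y ex ey → suc-injective (h (Fin.suc x) (Fin.suc y) ex ey)

countF≤ : ∀ {n} (p : Fin n → Bool) → countF p ≤ n
countF≤ {zero} p = z≤n
countF≤ {suc n} p with p Fin.zero
... | true = s≤s (countF≤ (p ∘ Fin.suc))
... | false = m≤n⇒m≤1+n (countF≤ (p ∘ Fin.suc))

countF-omit≤ : ∀ {n} (p : Fin (suc n) → Bool) x → p x ≡ false → countF p ≤ n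
countF-omit≤ p Fin.zero e rewrite e = countF≤ (p ∘ Fin.suc)
countF-omit≤ {suc n} p (Fin.suc x) e with p Fin.zero
... | true = s≤s (countF-omit≤ (p ∘ Fin.suc) x e)
... | false = m≤n⇒m≤1+n (countF-omit≤ (p ∘ Fin.suc) x e)

countF-interval : ∀ {n} (p : Fin n → Bool) lo hi →
  (∀ j → p j ≡ true → lo ≤ toℕ j × toℕ j < hi) → countF p ≤ hi ∸ lo
countF-interval {zero} p lo hi h = z≤n
countF-interval {suc n} p lo hi h with p Fin.zero in e
... | true with h Fin.zero e
...   | z≤n , s≤s _ =
  s≤s (countF-interval (p ∘ Fin.suc) 0 (pred hi) λ j ej → z≤n , s≤s⁻¹ (proj₂ (h (Fin.suc j) ej)))
countF-interval {suc n} p lo hi h | false = begin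
  countF (p ∘ Fin.suc)  ≤⟨ countF-interval (p ∘ Fin.suc) (pred lo) (pred hi) shifted ⟩
  pred hi ∸ pred lo     ≤⟨ pred∸pred≤ lo hi ⟩
  hi ∸ lo               ∎
  where
  open ≤-Reasoning
  shifted : ∀ j → p (Fin.suc j) ≡ true → pred lo ≤ toℕ j × toℕ j < pred hi
  shifted j ej with h (Fin.suc j) ej
  ... | lo≤ , s≤s <hi = pred-mono-≤ lo≤ , <hi
  pred∸pred≤ : ∀ lo hi → pred hi ∸ pred lo ≤ hi ∸ lo
  pred∸pred≤ zero hi = pred[n]≤n
  pred∸pred≤ (suc l) zero = ≤-reflexive (0∸n≡0 l)
  pred∸pred≤ (suc l) (suc h) = ≤-refl

enumerate : ∀ {n} (p : Fin n → Bool) →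
  Σ (Fin (countF p) → Fin n) λ f → (∀ r → p (f r) ≡ true) × Injective _≡_ _≡_ f
enumerate {zero} p = (λ ()) , (λ ()) , λ {}
enumerate {suc n} p with p Fin.zero in e | enumerate (p ∘ Fin.suc)
... | true | f , f-sound , f-inj = g , g-sound , g-inj
  where
  g : Fin (suc (countF (p ∘ Fin.suc))) → Fin (suc n)
  g Fin.zero = Fin.zero
  g (Fin.suc r) = Fin.suc (f r)
  g-sound : ∀ r → p (g r) ≡ true
  g-sound Fin.zero = e
  g-sound (Fin.suc r) = f-sound r
  g-inj : Injective _≡_ _≡_ g
  g-inj {Fin.zero} {Fin.zero} _ = refl
  g-inj {Fin.suc r₁} {Fin.suc r₂} q = cong Fin.suc (f-inj (suc-injective q))
... | false | f , f-sound , f-inj = Fin.suc ∘ f , f-sound , f-inj ∘ suc-injective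

countBelow : ∀ {n} → (Fin n → Bool) → ℕ → ℕ
countBelow q t = countF (λ j → ⌊ toℕ j <? t ⌋ ∧ q j)

countBelow-all : ∀ {n} (q : Fin n → Bool) → countBelow q n ≡ countF q
countBelow-all q = countF-cong λ j → cong (_∧ q j) (fromWitness≡ (toℕ j <? _) (toℕ<n j))

countAt : ∀ {n} → (Fin n → Bool) → ℕ → ℕ
countAt q t = countF (λ j → ⌊ toℕ j ℕ.≟ t ⌋ ∧ q j)

countAt-≤1 : ∀ {n} (q : Fin n → Bool) t → countAt q t ≤ 1
countAt-≤1 q t = countF-≤1 _ λ x y ex ey → toℕ-injective (trans (at-t x ex) (sym (at-t y ey)))
  where
  at-t : ∀ j → ⌊ toℕ j ℕ.≟ t ⌋ ∧ q j ≡ true → toℕ j ≡ t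
  at-t j e = toWitness≡ (toℕ j ℕ.≟ t) (proj₁ (∧-true e))

countBelow-suc : ∀ {n} (q : Fin n → Bool) t → countBelow q (suc t) ≤ countBelow q t + countAt q t
countBelow-suc q t =
  ≤-trans (countF-mono split) (countF-∨ (λ j → ⌊ toℕ j <? t ⌋ ∧ q j) (λ j → ⌊ toℕ j ℕ.≟ t ⌋ ∧ q j))
  where
  split : ∀ j → ⌊ toℕ j <? suc t ⌋ ∧ q j ≡ true →
          (⌊ toℕ j <? t ⌋ ∧ q j) ∨ (⌊ toℕ j ℕ.≟ t ⌋ ∧ q j) ≡ true
  split j e with ∧-true e
  ... | e₁ , e₂ with m<1+n⇒m<n∨m≡n (toWitness≡ (toℕ j <? suc t) e₁)
  ...   | inj₁ j<t = ∨-trueˡ _ (cong₂ _∧_ (fromWitness≡ (toℕ j <? t) j<t) e₂)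
  ...   | inj₂ j≡t = ∨-trueʳ _ (cong₂ _∧_ (fromWitness≡ (toℕ j ℕ.≟ t) j≡t) e₂)

countBelow-bounded : ∀ {n} (q : Fin n → Bool) d →
  (∀ j → q j ≡ true → countBelow q (toℕ j) < d) → ∀ t → countBelow q t ≤ d
countBelow-bounded q d hq zero =
  ≤-trans (≤-reflexive (countF-none {p = λ j → ⌊ toℕ j <? 0 ⌋ ∧ q j} λ _ → refl)) z≤n
countBelow-bounded q d hq (suc t) with 1 ≤? countAt q t
... | no none = begin
  countBelow q (suc t)              ≤⟨ countBelow-suc q t ⟩
  countBelow q t + countAt q t      ≡⟨ cong (countBelow q t +_) (n<1⇒n≡0 (≰⇒> none)) ⟩
  countBelow q t + 0                ≡⟨ +-identityʳ _ ⟩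
  countBelow q t                    ≤⟨ countBelow-bounded q d hq t ⟩
  d                                 ∎
  where open ≤-Reasoning
... | yes some with countF-witness _ some
...   | j₀ , e with ∧-true {⌊ toℕ j₀ ℕ.≟ t ⌋} e
...     | j₀≡t , qj₀ = begin
  countBelow q (suc t)              ≤⟨ countBelow-suc q t ⟩
  countBelow q t + countAt q t      ≤⟨ +-monoʳ-≤ (countBelow q t) (countAt-≤1 q t) ⟩
  countBelow q t + 1                ≡⟨ +-comm _ 1 ⟩
  suc (countBelow q t)              ≡⟨ cong (suc ∘ countBelow q) (toWitness≡ (toℕ j₀ ℕ.≟ t) j₀≡t) ⟨
  suc (countBelow q (toℕ j₀))       ≤⟨ hq j₀ qj₀ ⟩
  d                                 ∎
  where open ≤-Reasoning

sumF : ∀ {n} → (Fin n → ℕ) → ℕ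
sumF {zero} f = 0
sumF {suc n} f = f Fin.zero + sumF (f ∘ Fin.suc)

sumF-+ : ∀ {n} (f g : Fin n → ℕ) → sumF (λ i → f i + g i) ≡ sumF f + sumF g
sumF-+ {zero} f g = refl
sumF-+ {suc n} f g = trans (cong (f Fin.zero + g Fin.zero +_) (sumF-+ (f ∘ Fin.suc) (g ∘ Fin.suc)))
  (+-interchange (f Fin.zero) (g Fin.zero) _ _)

sumF-term : ∀ {n} (f : Fin n → ℕ) i → f i ≤ sumF f
sumF-term f Fin.zero = m≤m+n _ _
sumF-term f (Fin.suc i) = ≤-trans (sumF-term (f ∘ Fin.suc) i) (m≤n+m _ _)

sumF-mono : ∀ {n} {f g : Fin n → ℕ} → (∀ i → f i ≤ g i) → sumF f ≤ sumF g
sumF-mono {zero} h = z≤n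
sumF-mono {suc n} h = +-mono-≤ (h Fin.zero) (sumF-mono (h ∘ Fin.suc))

sumF-const : ∀ n c → sumF {n} (λ _ → c) ≡ n * c
sumF-const zero c = refl
sumF-const (suc n) c = cong (c +_) (sumF-const n c)

clusterSizes-sum : ∀ {k} n (a : Fin n → Fin (suc k)) → n ≤ sumF (clusterSize a)
clusterSizes-sum zero a = z≤n
clusterSizes-sum (suc n) a = begin
  1 + n
    ≤⟨ +-mono-≤ own-cluster (clusterSizes-sum n (a ∘ Fin.suc)) ⟩
  sumF (λ i → bit ⌊ a Fin.zero ≟ i ⌋) + sumF (clusterSize (a ∘ Fin.suc))
    ≡⟨ sumF-+ (λ i → bit ⌊ a Fin.zero ≟ i ⌋) (clusterSize (a ∘ Fin.suc)) ⟨
  sumF (clusterSize a) ∎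
  where
  open ≤-Reasoning
  own-cluster : 1 ≤ sumF (λ i → bit ⌊ a Fin.zero ≟ i ⌋)
  own-cluster = ≤-trans (≤-reflexive (cong bit (sym (fromWitness≡ (a Fin.zero ≟ a Fin.zero) refl))))
                        (sumF-term (λ i → bit ⌊ a Fin.zero ≟ i ⌋) (a Fin.zero))

largestCluster-size : ∀ {n k} (a : Fin n → Fin (suc k)) m → LargestCluster a m →
  n ≤ suc k * clusterSize a m
largestCluster-size {n} {k} a m largest = begin
  n                                ≤⟨ clusterSizes-sum n a ⟩
  sumF (clusterSize a)             ≤⟨ sumF-mono largest ⟩
  sumF {suc k} (λ _ → clusterSize a m)
                                   ≡⟨ sumF-const (suc k) _ ⟩
  suc k * clusterSize a m          ∎
  where open ≤-Reasoning

countL : ∀ {A : Set} → (A → Bool) → List A → ℕ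
countL p [] = 0
countL p (x ∷ xs) = bit (p x) + countL p xs

countL-filter-length : ∀ {A : Set} {ℓ} {P : Pred A ℓ} (P? : Decidable P) xs →
  length (filter P? xs) ≡ countL (λ x → ⌊ P? x ⌋) xs
countL-filter-length P? [] = refl
countL-filter-length P? (x ∷ xs) with P? x
... | yes _ = cong suc (countL-filter-length P? xs)
... | no _ = countL-filter-length P? xs

countL-map : ∀ {A B : Set} (p : B → Bool) (h : A → B) xs → countL p (map h xs) ≡ countL (p ∘ h) xs
countL-map p h [] = refl
countL-map p h (x ∷ xs) = cong (bit (p (h x)) +_) (countL-map p h xs)

countL-filter : ∀ {A : Set} {ℓ} {P : Pred A ℓ} (P? : Decidable P) (p : A → Bool) xs →
  countL p (filter P? xs) ≡ countL (λ x → ⌊ P? x ⌋ ∧ p x) xs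
countL-filter P? p [] = refl
countL-filter P? p (x ∷ xs) with P? x
... | yes _ = cong (bit (p x) +_) (countL-filter P? p xs)
... | no _ = countL-filter P? p xs

countL-tabulate : ∀ {A : Set} {n} (p : A → Bool) (f : Fin n → A) → countL p (tabulate f) ≡ countF (p ∘ f)
countL-tabulate {n = zero} p f = refl
countL-tabulate {n = suc n} p f = cong (bit (p (f Fin.zero)) +_) (countL-tabulate p (f ∘ Fin.suc))

any⇒countL : ∀ {A : Set} (p : A → Bool) xs → any p xs ≡ true → 1 ≤ countL p xs
any⇒countL p (x ∷ xs) e with p x
... | true = s≤s z≤n
... | false = any⇒countL p xs e

countL⇒any : ∀ {A : Set} (p : A → Bool) xs → 1 ≤ countL p xs → any p xs ≡ true
countL⇒any p (x ∷ xs) e with p x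
... | true = refl
... | false = countL⇒any p xs e

two-budgets : ∀ α β α′ β′ {D} → suc (α + β) ≤ D → suc (α′ + β′) ≤ D → α + α′ ≤ D ⊎ β + β′ ≤ D
two-budgets α β α′ β′ {D} h h′ with α + α′ ≤? D
... | yes α+α′≤D = inj₁ α+α′≤D
... | no α+α′≰D = inj₂ (+-cancelˡ-≤ (suc D) _ _ (begin
  suc D + (β + β′)       ≤⟨ +-monoˡ-≤ (β + β′) (≰⇒> α+α′≰D) ⟩
  (α + α′) + (β + β′)    ≡⟨ +-interchange α α′ β β′ ⟩
  (α + β) + (α′ + β′)    ≤⟨ +-mono-≤ (<⇒≤ h) (<⇒≤ h′) ⟩
  D + D                  ≤⟨ n≤1+n _ ⟩
  suc D + D              ∎))
  where open ≤-Reasoning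

-- Walks and distances

module _ {n : ℕ} where

  Adj : Set
  Adj = Fin n → Fin n → Bool

  SymmetricAdj : Adj → Set
  SymmetricAdj b = ∀ u v → b u v ≡ b v u

  Subgraph : Adj → Adj → Set
  Subgraph b b′ = ∀ u v → b u v ≡ true → b′ u v ≡ true

  walk-mono : ∀ {b b′ : Adj} → Subgraph b b′ → ∀ {u v ℓ} → Walk b u v ℓ → Walk b′ u v ℓ
  walk-mono h here = here
  walk-mono h (step e w) = step (h _ _ e) (walk-mono h w)

  walk-++ : ∀ {b : Adj} {u v w ℓ₁ ℓ₂} → Walk b u v ℓ₁ → Walk b v w ℓ₂ → Walk b u w (ℓ₁ + ℓ₂)
  walk-++ here q = q
  walk-++ (step e p) q = step e (walk-++ p q)

  walk-reverse : ∀ {b : Adj} → SymmetricAdj b → ∀ {u v ℓ} → Walk b u v ℓ → Walk b v u ℓ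
  walk-reverse b-sym here = here
  walk-reverse {b} b-sym {u} {v} (step {w = w} {ℓ = ℓ} e p) =
    subst (Walk b v u) (+-comm ℓ 1) (walk-++ (walk-reverse b-sym p) (step (trans (b-sym w u) e) here))

  within-refl : ∀ {b : Adj} u → Within b u u 0
  within-refl u = 0 , z≤n , here

  within-trans : ∀ {b : Adj} {u v w s t} → Within b u v s → Within b v w t → Within b u w (s + t)
  within-trans (ℓ₁ , ℓ₁≤s , p) (ℓ₂ , ℓ₂≤t , q) = ℓ₁ + ℓ₂ , +-mono-≤ ℓ₁≤s ℓ₂≤t , walk-++ p q

  within-sym : ∀ {b : Adj} → SymmetricAdj b → ∀ {u v t} → Within b u v t → Within b v u t
  within-sym b-sym (ℓ , ℓ≤t , p) = ℓ , ℓ≤t , walk-reverse b-sym p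

  within-weaken : ∀ {b : Adj} {u v s t} → s ≤ t → Within b u v s → Within b u v t
  within-weaken s≤t (ℓ , ℓ≤s , p) = ℓ , ≤-trans ℓ≤s s≤t , p

  within-mono : ∀ {b b′ : Adj} → Subgraph b b′ → ∀ {u v t} → Within b u v t → Within b′ u v t
  within-mono h (ℓ , ℓ≤t , p) = ℓ , ℓ≤t , walk-mono h p

  within-edge : ∀ {b : Adj} {u v} → b u v ≡ true → Within b u v 1
  within-edge e = 1 , ≤-refl , step e here

  within-zero : ∀ {b : Adj} {u v} → Within b u v 0 → u ≡ v
  within-zero (0 , _ , here) = refl

  joins : Fin n × Fin n → Fin n → Fin n → Bool
  joins p u v = (⌊ proj₁ p ≟ u ⌋ ∧ ⌊ proj₂ p ≟ v ⌋) ∨ (⌊ proj₁ p ≟ v ⌋ ∧ ⌊ proj₂ p ≟ u ⌋)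

  joins-sym : ∀ p u v → joins p u v ≡ joins p v u
  joins-sym p u v = ∨-comm (⌊ proj₁ p ≟ u ⌋ ∧ ⌊ proj₂ p ≟ v ⌋) (⌊ proj₁ p ≟ v ⌋ ∧ ⌊ proj₂ p ≟ u ⌋)

  joins-endpoints : ∀ x y u v → joins (x , y) u v ≡ true → (x ≡ u × y ≡ v) ⊎ (x ≡ v × y ≡ u)
  joins-endpoints x y u v e with ∨-true {⌊ x ≟ u ⌋ ∧ ⌊ y ≟ v ⌋} e
  ... | inj₁ e₁ = inj₁ (toWitness≡ (x ≟ u) (proj₁ (∧-true e₁)) , toWitness≡ (y ≟ v) (proj₂ (∧-true e₁)))
  ... | inj₂ e₂ = inj₂ (toWitness≡ (x ≟ v) (proj₁ (∧-true e₂)) , toWitness≡ (y ≟ u) (proj₂ (∧-true e₂)))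

  joins-self : ∀ x y → joins (x , y) x y ≡ true
  joins-self x y = ∨-trueˡ _ (cong₂ _∧_ (fromWitness≡ (x ≟ x) refl) (fromWitness≡ (y ≟ y) refl))

  edgeIn-sym : ∀ u v M → edgeIn u v M ≡ edgeIn v u M
  edgeIn-sym u v [] = refl
  edgeIn-sym u v (p ∷ M) = cong₂ _∨_ (joins-sym p u v) (edgeIn-sym u v M)

  _+ₑ_ : Adj → Fin n × Fin n → Adj
  (b +ₑ p) u v = b u v ∨ joins p u v

  +ₑ-sym : ∀ {b} → SymmetricAdj b → ∀ p → SymmetricAdj (b +ₑ p)
  +ₑ-sym b-sym p u v = cong₂ _∨_ (b-sym u v) (joins-sym p u v)

  ViaEdge : Adj → Fin n → Fin n → ℕ → Fin n → Fin n → Set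
  ViaEdge b x y ℓ p q = ∃₂ λ α β → suc (α + β) ≤ ℓ × Within b p x α × Within b y q β

  Decomposition : Adj → Fin n → Fin n → ℕ → Fin n → Fin n → Set
  Decomposition b x y ℓ p q = Within b p q ℓ ⊎ ViaEdge b x y ℓ p q ⊎ ViaEdge b y x ℓ p q

  private
    via-tail≤ : ∀ {α β ℓ} → suc (α + β) ≤ ℓ → β ≤ ℓ
    via-tail≤ {α} {β} h = ≤-trans (m≤n+m β α) (≤-trans (n≤1+n _) h)

    prepend-edge : ∀ {b : Adj} {x y p w q ℓ} → b p w ≡ true →
      Decomposition b x y ℓ w q → Decomposition b x y (suc ℓ) p q
    prepend-edge e = Sum.map (within-trans (within-edge e)) (Sum.map prepend prepend)
      where
      prepend : ∀ {x y q ℓ} → ViaEdge _ x y ℓ _ q → ViaEdge _ x y (suc ℓ) _ q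
      prepend (α , β , h , W₁ , W₂) = suc α , β , s≤s h , within-trans (within-edge e) W₁ , W₂

    -- A second crossing of the new edge can be short-cut.
    prepend-new-edge : ∀ {b : Adj} {x y q ℓ} →
      Decomposition b x y ℓ y q → Decomposition b x y (suc ℓ) x q
    prepend-new-edge {ℓ = ℓ} (inj₁ W) = inj₂ (inj₁ (0 , ℓ , ≤-refl , within-refl _ , W))
    prepend-new-edge (inj₂ (inj₁ (α , β , h , _ , W))) =
      inj₂ (inj₁ (0 , β , s≤s (via-tail≤ h) , within-refl _ , W))
    prepend-new-edge (inj₂ (inj₂ (α , β , h , _ , W))) =
      inj₁ (within-weaken (m≤n⇒m≤1+n (via-tail≤ h)) W)

    swap-crossing : ∀ {b : Adj} {x y ℓ p q} → Decomposition b x y ℓ p q → Decomposition b y x ℓ p q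
    swap-crossing = Sum.map₂ Sum.swap

  walk-+ₑ : ∀ {b : Adj} {x y p q ℓ} → Walk (b +ₑ (x , y)) p q ℓ → Decomposition b x y ℓ p q
  walk-+ₑ here = inj₁ (within-refl _)
  walk-+ₑ {b} {x} {y} {p} (step {w = w} e rest) with ∨-true {b p w} e
  ... | inj₁ e-old = prepend-edge e-old (walk-+ₑ rest)
  ... | inj₂ e-new with joins-endpoints x y p w e-new
  ...   | inj₁ (refl , refl) = prepend-new-edge (walk-+ₑ rest)
  ...   | inj₂ (refl , refl) = swap-crossing (prepend-new-edge (swap-crossing (walk-+ₑ rest)))

  via-flip : ∀ {b : Adj} → SymmetricAdj b → ∀ {x y ℓ p q} → ViaEdge b y x ℓ p q → ViaEdge b x y ℓ q p
  via-flip b-sym {ℓ = ℓ} (α , β , h , W₁ , W₂) =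
    β , α , subst (λ s → suc s ≤ ℓ) (+-comm α β) h , within-sym b-sym W₂ , within-sym b-sym W₁

  within-+ₑ : ∀ {b : Adj} → SymmetricAdj b → ∀ {x y p q D} → Within (b +ₑ (x , y)) p q D →
    Within b p q D ⊎ ViaEdge b x y D p q ⊎ ViaEdge b x y D q p
  within-+ₑ b-sym (ℓ , ℓ≤D , w) =
    Sum.map (within-weaken ℓ≤D) (Sum.map (weaken-via ℓ≤D) (via-flip b-sym ∘ weaken-via ℓ≤D)) (walk-+ₑ w)
    where
    weaken-via : ∀ {b : Adj} {x y ℓ D p q} → ℓ ≤ D → ViaEdge b x y ℓ p q → ViaEdge b x y D p q
    weaken-via ℓ≤D (α , β , h , W₁ , W₂) = α , β , ≤-trans h ℓ≤D , W₁ , W₂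

  via-combine : ∀ {b : Adj} → SymmetricAdj b → ∀ {x y D p q p′ q′} →
    ViaEdge b x y D p q → ViaEdge b x y D p′ q′ → Within b p p′ D ⊎ Within b q q′ D
  via-combine b-sym (α , β , h , Wpx , Wyq) (α′ , β′ , h′ , Wp′x , Wyq′) =
    Sum.map (λ le → within-weaken le (within-trans Wpx (within-sym b-sym Wp′x)))
            (λ le → within-weaken le (within-trans (within-sym b-sym Wyq) Wyq′))
            (two-budgets α β α′ β′ h h′)

-- Few added edges cannot bring many far-apart points together

ClosePair : ∀ {n K} → Adj {n} → ℕ → (Fin K → Fin n) → Set
ClosePair b D P = ∃₂ λ i j → i ≢ j × Within b (P i) (P j) D

module DisjointPairsOrTriangle {A : Set} (_≟ₐ_ : DecidableEquality A)
                               (C : A → A → Set) (C-sym : ∀ {i j} → C i j → C j i) where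

  MissedBy : A → Set
  MissedBy v = ∃₂ λ i j → i ≢ j × i ≢ v × j ≢ v × C i j

  data Configuration : Set where
    disjoint : ∀ {i j i′ j′} → i ≢ j → i′ ≢ j′ → i ≢ i′ → i ≢ j′ → j ≢ i′ → j ≢ j′ →
               C i j → C i′ j′ → Configuration
    triangle : ∀ {i j u} → i ≢ j → j ≢ u → u ≢ i → C i j → C j u → C u i → Configuration

  private
    wedge-closed : ∀ {i j u w} → i ≢ j → j ≢ u → u ≢ i → w ≢ u → w ≢ j →
      C i j → C j u → C u w → Configuration
    wedge-closed {i} {w = w} i≢j j≢u u≢i w≢u w≢j Cij Cju Cuw with w ≟ₐ i
    ... | yes refl = triangle i≢j j≢u u≢i Cij Cju Cuw
    ... | no w≢i = disjoint i≢j (≢-sym w≢u) (≢-sym u≢i) (≢-sym w≢i) j≢u (≢-sym w≢j) Cij Cuw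

    wedge : ∀ {i j u} → i ≢ j → j ≢ u → u ≢ i → C i j → C j u → MissedBy j → Configuration
    wedge {u = u} i≢j j≢u u≢i Cij Cju (i₃ , j₃ , i₃≢j₃ , i₃≢j , j₃≢j , C₃) with i₃ ≟ₐ u | j₃ ≟ₐ u
    ... | no i₃≢u | no j₃≢u =
      disjoint j≢u i₃≢j₃ (≢-sym i₃≢j) (≢-sym j₃≢j) (≢-sym i₃≢u) (≢-sym j₃≢u) Cju C₃
    ... | yes refl | _ = wedge-closed i≢j j≢u u≢i (≢-sym i₃≢j₃) j₃≢j Cij Cju C₃
    ... | no _ | yes refl = wedge-closed i≢j j≢u u≢i i₃≢j₃ i₃≢j Cij Cju (C-sym C₃)

  configuration : A → (∀ v → MissedBy v) → Configuration
  configuration v₀ missed with missed v₀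
  ... | i , j , i≢j , _ , _ , Cij with missed i
  ...   | i₂ , j₂ , i₂≢j₂ , i₂≢i , j₂≢i , C₂ with i₂ ≟ₐ j | j₂ ≟ₐ j
  ...     | no i₂≢j | no j₂≢j =
    disjoint i≢j i₂≢j₂ (≢-sym i₂≢i) (≢-sym j₂≢i) (≢-sym i₂≢j) (≢-sym j₂≢j) Cij C₂
  ...     | yes refl | _ = wedge i≢j i₂≢j₂ j₂≢i Cij C₂ (missed i₂)
  ...     | no _ | yes refl = wedge i≢j (≢-sym i₂≢j₂) i₂≢i Cij (C-sym C₂) (missed j₂)

module _ {n K : ℕ} {b : Adj {n}} (b-sym : SymmetricAdj b) {x y : Fin n} {D : ℕ} (P : Fin K → Fin n) where

  private
    C₁ : Fin K → Fin K → Set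
    C₁ i j = Within (b +ₑ (x , y)) (P i) (P j) D

    C₁-sym : ∀ {i j} → C₁ i j → C₁ j i
    C₁-sym = within-sym (+ₑ-sym b-sym (x , y))

    Via : Fin K → Fin K → Set
    Via i j = ViaEdge b x y D (P i) (P j)

    via-pair : ∀ {i j i′ j′} → i ≢ i′ → j ≢ j′ → Via i j → Via i′ j′ → ClosePair b D P
    via-pair {i} {j} {i′} {j′} i≢i′ j≢j′ V V′ with via-combine b-sym V V′
    ... | inj₁ W = i , i′ , i≢i′ , W
    ... | inj₂ W = j , j′ , j≢j′ , W

    orient : ∀ {i j} → i ≢ j → C₁ i j → ClosePair b D P ⊎ Via i j ⊎ Via j i
    orient {i} {j} i≢j W = Sum.map₁ (λ W₀ → i , j , i≢j , W₀) (within-+ₑ b-sym W)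

    -- Every triangle of oriented crossings contains a directed path of length two.
    oriented-triangle : ∀ {i j u} → i ≢ j → j ≢ u → u ≢ i → Via i j → C₁ j u → C₁ u i → ClosePair b D P
    oriented-triangle i≢j j≢u u≢i Vij Cju Cui with orient j≢u Cju
    ... | inj₁ close = close
    ... | inj₂ (inj₁ Vju) = via-pair i≢j j≢u Vij Vju
    ... | inj₂ (inj₂ Vuj) with orient u≢i Cui
    ...   | inj₁ close = close
    ...   | inj₂ (inj₁ Vui) = via-pair u≢i i≢j Vui Vij
    ...   | inj₂ (inj₂ Viu) = via-pair (≢-sym u≢i) (≢-sym j≢u) Viu Vuj

  open DisjointPairsOrTriangle _≟_ C₁ C₁-sym

  configuration⇒closePair : Configuration → ClosePair b D P
  configuration⇒closePair (disjoint i≢j i′≢j′ i≢i′ i≢j′ j≢i′ j≢j′ Cij Ci′j′)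
    with orient i≢j Cij | orient i′≢j′ Ci′j′
  ... | inj₁ close | _ = close
  ... | inj₂ _ | inj₁ close = close
  ... | inj₂ (inj₁ V) | inj₂ (inj₁ V′) = via-pair i≢i′ j≢j′ V V′
  ... | inj₂ (inj₁ V) | inj₂ (inj₂ V′) = via-pair i≢j′ j≢i′ V V′
  ... | inj₂ (inj₂ V) | inj₂ (inj₁ V′) = via-pair j≢i′ i≢j′ V V′
  ... | inj₂ (inj₂ V) | inj₂ (inj₂ V′) = via-pair j≢j′ i≢i′ V V′
  configuration⇒closePair (triangle i≢j j≢u u≢i Cij Cju Cui) with orient i≢j Cij
  ... | inj₁ close = close
  ... | inj₂ (inj₁ Vij) = oriented-triangle i≢j j≢u u≢i Vij Cju Cui
  ... | inj₂ (inj₂ Vji) = oriented-triangle (≢-sym i≢j) (≢-sym u≢i) (≢-sym j≢u) Vji (C₁-sym Cui) (C₁-sym Cju)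

closePair-of-augmentation : ∀ {n} (M : List (Fin n × Fin n)) k (b : Adj) D → SymmetricAdj b →
  length M ≤ k → DiamLe (λ u v → b u v ∨ edgeIn u v M) D → (P : Fin (2 + k) → Fin n) → ClosePair b D P
closePair-of-augmentation [] k b D b-sym _ diam P =
  Fin.zero , Fin.suc Fin.zero , (λ ()) ,
  within-mono (λ u v e → trans (sym (∨-identityʳ (b u v))) e) (diam (P Fin.zero) (P (Fin.suc Fin.zero)))
closePair-of-augmentation ((x , y) ∷ M) (suc k) b D b-sym (s≤s |M|≤k) diam P =
  configuration⇒closePair b-sym {x} {y} P (configuration Fin.zero missed)
  where
  b₁ : Adj
  b₁ = b +ₑ (x , y)
  b₁-sym : SymmetricAdj b₁
  b₁-sym = +ₑ-sym b-sym (x , y)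
  diam₁ : DiamLe (λ u v → b₁ u v ∨ edgeIn u v M) D
  diam₁ u v = within-mono (λ u v e → trans (∨-assoc (b u v) (joins (x , y) u v) (edgeIn u v M)) e) (diam u v)
  open DisjointPairsOrTriangle _≟_ (λ i j → Within b₁ (P i) (P j) D) (within-sym b₁-sym)
  missed : ∀ v → MissedBy v
  missed v with closePair-of-augmentation M k b₁ D b₁-sym |M|≤k diam₁ (P ∘ punchIn v)
  ... | i , j , i≢j , W =
    punchIn v i , punchIn v j , i≢j ∘ punchIn-injective v i j , punchInᵢ≢i v i , punchInᵢ≢i v j , W

incidentTo : ∀ {n} → Fin n → Fin n × Fin n → Bool
incidentTo v p = ⌊ (⌊ proj₁ p ≟ v ⌋ ∨ ⌊ proj₂ p ≟ v ⌋) Bool.≟ true ⌋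

incid≡countL : ∀ {n} (v : Fin n) L → incid v L ≡ countL (incidentTo v) L
incid≡countL v L = countL-filter-length _ L

incidentTo-endpoints : ∀ {n} {v x y : Fin n} → incidentTo v (x , y) ≡ true → x ≡ v ⊎ y ≡ v
incidentTo-endpoints {v = v} {x} {y} e =
  Sum.map (toWitness≡ (x ≟ v)) (toWitness≡ (y ≟ v)) (∨-true (trans (sym (⌊≟true⌋ _)) e))

joins⇒incidentTo : ∀ {n} {v u x y : Fin n} → joins (x , y) v u ≡ true → incidentTo v (x , y) ≡ true
joins⇒incidentTo {v = v} {u} {x} {y} e = trans (⌊≟true⌋ _) (endpoint (joins-endpoints x y v u e))
  where
  endpoint : (x ≡ v × y ≡ u) ⊎ (x ≡ u × y ≡ v) → ⌊ x ≟ v ⌋ ∨ ⌊ y ≟ v ⌋ ≡ true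
  endpoint (inj₁ (x≡v , _)) = ∨-trueˡ _ (fromWitness≡ (x ≟ v) x≡v)
  endpoint (inj₂ (_ , y≡v)) = ∨-trueʳ _ (fromWitness≡ (y ≟ v) y≡v)

joins-neighbours≤ : ∀ {n} (v : Fin n) e → countF (joins e v) ≤ bit (incidentTo v e)
joins-neighbours≤ v (x , y) with incidentTo v (x , y) in incident
... | true = countF-≤1 _ unique
  where
  unique : ∀ u₁ u₂ → joins (x , y) v u₁ ≡ true → joins (x , y) v u₂ ≡ true → u₁ ≡ u₂
  unique u₁ u₂ e₁ e₂ with joins-endpoints x y v u₁ e₁ | joins-endpoints x y v u₂ e₂
  ... | inj₁ (refl , refl) | inj₁ (refl , refl) = refl
  ... | inj₁ (refl , refl) | inj₂ (refl , refl) = refl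
  ... | inj₂ (refl , refl) | inj₁ (refl , refl) = refl
  ... | inj₂ (refl , refl) | inj₂ (refl , refl) = refl
... | false = ≤-reflexive (countF-none not-joined)
  where
  not-joined : ∀ u → joins (x , y) v u ≡ false
  not-joined u with joins (x , y) v u in e
  ... | true = ⊥-elim (true≢false (trans (sym (joins⇒incidentTo {v = v} {u} {x} {y} e)) incident))
  ... | false = refl

newNeighbours≤incid : ∀ {n} (v : Fin n) M → countF (λ u → edgeIn v u M) ≤ incid v M
newNeighbours≤incid v M = ≤-trans (bound M) (≤-reflexive (sym (incid≡countL v M)))
  where
  bound : ∀ M → countF (λ u → edgeIn v u M) ≤ countL (incidentTo v) M
  bound [] = ≤-reflexive (countF-none {p = λ u → edgeIn v u []} λ _ → refl)
  bound (e ∷ M) = ≤-trans (countF-∨ (joins e v) (λ u → edgeIn v u M))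
                          (+-mono-≤ (joins-neighbours≤ v e) (bound M))

-- Farthest-first centres cover the graph

farthestFirst-radius : ∀ {n k D} (G : Graph n) (c : Fin (suc k) → Fin n) → FarthestFirst G c →
  ((P : Fin (2 + k) → Fin n) → ClosePair (adj G) D P) → ∀ w → ∃[ j ] Within (adj G) w (c j) D
farthestFirst-radius {D = D} G c ff close w with close (w Vector.∷ c)
... | Fin.zero , Fin.zero , i≢j , _ = ⊥-elim (i≢j refl)
... | Fin.zero , Fin.suc j , _ , W = j , W
... | Fin.suc i , Fin.zero , _ , W = i , within-sym (Graph.sym G) W
... | Fin.suc i , Fin.suc j , i≢j , W with <-cmp (toℕ i) (toℕ j)
...   | tri< i<j _ _ = map₂ proj₂ (ff j (≤-trans (s≤s z≤n) i<j) w D (i , i<j , within-sym (Graph.sym G) W))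
...   | tri≈ _ i≡j _ = ⊥-elim (i≢j (cong Fin.suc (toℕ-injective i≡j)))
...   | tri> _ _ j<i = map₂ proj₂ (ff i (≤-trans (s≤s z≤n) j<i) w D (j , j<i , W))

module Algorithm {n k : ℕ} (G : Graph n) (c : Fin (suc k) → Fin n) (ff : FarthestFirst G c)
                 (a : Fin n → Fin (suc k)) (nearest : NearestAssign G c a) (m : Fin (suc k)) where

  Active : Fin (suc k) → Set
  Active j = c j ≢ c m

  active? : Fin (suc k) → Bool
  active? j = ⌊ ¬? (c j ≟ c m) ⌋

  active?-sound : ∀ {j} → active? j ≡ true → Active j
  active?-sound {j} = toWitness≡ (¬? (c j ≟ c m))

  active?-complete : ∀ {j} → Active j → active? j ≡ true
  active?-complete {j} = fromWitness≡ (¬? (c j ≟ c m))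

  centre-self-assigned : ∀ j → c (a (c j)) ≡ c j
  centre-self-assigned j = sym (within-zero (nearest (c j) j 0 (within-refl (c j))))

  centre-in-largest : ∀ {w} j → a w ≡ m → w ≡ c j → w ≡ c m
  centre-in-largest j refl refl = sym (centre-self-assigned j)

  active-centre-outside : ∀ {j} → Active j → a (c j) ≢ m
  active-centre-outside {j} act acj≡m = act (centre-in-largest j acj≡m refl)

  -- A repeated centre is at distance 0 from the earlier centres, so by the farthest-first rule
  -- every vertex is a centre; hence the largest cluster is {c m}.
  later-repeat⇒singleton : ∀ i j → toℕ j < toℕ i → c i ≡ c j → ∀ w → a w ≡ m → w ≡ c m
  later-repeat⇒singleton i j j<i ci≡cj w aw≡m
    with ff i (≤-trans (s≤s z≤n) j<i) w 0
            (j , j<i , subst (λ z → Within (adj G) (c i) z 0) ci≡cj (within-refl (c i)))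
  ... | j′ , _ , W = centre-in-largest j′ aw≡m (within-zero W)

  repeated-centre : ∀ i j → c i ≡ c j → i ≡ j ⊎ (∀ w → a w ≡ m → w ≡ c m)
  repeated-centre i j ci≡cj with <-cmp (toℕ i) (toℕ j)
  ... | tri< i<j _ _ = inj₂ (later-repeat⇒singleton j i i<j (sym ci≡cj))
  ... | tri≈ _ i≡j _ = inj₁ (toℕ-injective i≡j)
  ... | tri> _ _ j<i = inj₂ (later-repeat⇒singleton i j j<i ci≡cj)

  countL-activeIdx : ∀ q → countL q (activeIdx c m) ≡ countF (λ j → active? j ∧ q j)
  countL-activeIdx q = trans (countL-filter (λ j → ¬? (c j ≟ c m)) q (allFin (suc k)))
                             (countL-tabulate (λ j → active? j ∧ q j) id)

  module _ (g : Fin (suc k) → Fin n) where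

    private
      edge : Fin (suc k) → Fin n × Fin n
      edge j = c j , g j

    countL-addedEdges : ∀ f → countL f (addedEdges c m g) ≡ countF (λ j → active? j ∧ f (edge j))
    countL-addedEdges f = trans (countL-map f edge (activeIdx c m)) (countL-activeIdx (f ∘ edge))

    countL-addedBefore : ∀ f i →
      countL f (addedBefore c m g i) ≡ countBelow (λ j → active? j ∧ f (edge j)) (toℕ i)
    countL-addedBefore f i = begin
      countL f (addedBefore c m g i)
        ≡⟨ countL-map f edge (filter (λ j → toℕ j <? toℕ i) (activeIdx c m)) ⟩
      countL (f ∘ edge) (filter (λ j → toℕ j <? toℕ i) (activeIdx c m))
        ≡⟨ countL-filter (λ j → toℕ j <? toℕ i) (f ∘ edge) (activeIdx c m) ⟩
      countL (λ j → ⌊ toℕ j <? toℕ i ⌋ ∧ f (edge j)) (activeIdx c m)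
        ≡⟨ countL-activeIdx (λ j → ⌊ toℕ j <? toℕ i ⌋ ∧ f (edge j)) ⟩
      countF (λ j → active? j ∧ (⌊ toℕ j <? toℕ i ⌋ ∧ f (edge j)))
        ≡⟨ countF-cong (λ j → ∧-swap (active? j) ⌊ toℕ j <? toℕ i ⌋ (f (edge j))) ⟩
      countBelow (λ j → active? j ∧ f (edge j)) (toℕ i) ∎
      where open ≡-Reasoning

    addedEdges-length : length (addedEdges c m g) ≤ k
    addedEdges-length = begin
      length (addedEdges c m g)         ≡⟨ length-map edge (activeIdx c m) ⟩
      length (activeIdx c m)            ≡⟨ countL-filter-length (λ j → ¬? (c j ≟ c m)) (allFin (suc k)) ⟩
      countL active? (allFin (suc k))   ≡⟨ countL-tabulate active? id ⟩
      countF active?                    ≤⟨ countF-omit≤ active? m m-inactive ⟩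
      k                                 ∎
      where
      open ≤-Reasoning
      m-inactive : active? m ≡ false
      m-inactive = fromWitnessFalse≡ (¬? (c m ≟ c m)) (λ ne → ne refl)

    addedEdges-∋ : ∀ i → Active i → edgeIn (c i) (g i) (addedEdges c m g) ≡ true
    addedEdges-∋ i act = countL⇒any joins-at (addedEdges c m g) (begin
      1                                              ≤⟨ countF-pos (λ j → active? j ∧ joins-at (edge j)) i i-joined ⟩
      countF (λ j → active? j ∧ joins-at (edge j))   ≡⟨ countL-addedEdges joins-at ⟨
      countL joins-at (addedEdges c m g)             ∎)
      where
      open ≤-Reasoning
      joins-at : Fin n × Fin n → Bool
      joins-at p = joins p (c i) (g i)
      i-joined : active? i ∧ joins-at (edge i) ≡ true
      i-joined = cong₂ _∧_ (active?-complete act) (joins-self (c i) (g i))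

    addedEdges-∈ : ∀ u v → edgeIn u v (addedEdges c m g) ≡ true →
      ∃[ j ] (Active j × ((c j ≡ u × g j ≡ v) ⊎ (c j ≡ v × g j ≡ u)))
    addedEdges-∈ u v e with countF-witness _ (≤-trans (any⇒countL _ (addedEdges c m g) e)
                                                     (≤-reflexive (countL-addedEdges (λ p → joins p u v))))
    ... | j , ej with ∧-true {active? j} ej
    ...   | act , joined = j , active?-sound act , joins-endpoints (c j) (g j) u v joined

  module _ {δ : ℕ} {g : Fin (suc k) → Fin n} (valid : ValidChoice c a m δ g) where

    private
      Mg : List (Fin n × Fin n)
      Mg = addedEdges c m g

    incid-largest : ∀ v → a v ≡ m → incid v Mg ≤ δ
    incid-largest v av≡m = begin
      incid v Mg                        ≡⟨ incid≡countL v Mg ⟩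
      countL (incidentTo v) Mg          ≡⟨ countL-addedEdges g (incidentTo v) ⟩
      countF q                          ≡⟨ countBelow-all q ⟨
      countBelow q (suc k)              ≤⟨ countBelow-bounded q δ earlier-few (suc k) ⟩
      δ                                 ∎
      where
      open ≤-Reasoning
      q : Fin (suc k) → Bool
      q j = active? j ∧ incidentTo v (c j , g j)
      earlier-few : ∀ j → q j ≡ true → countBelow q (toℕ j) < δ
      earlier-few j qj with ∧-true {active? j} qj
      ... | act , incident with active?-sound act | incidentTo-endpoints {v = v} {c j} {g j} incident
      ...   | act′ | inj₁ refl = ⊥-elim (active-centre-outside act′ av≡m)
      ...   | act′ | inj₂ refl = begin-strict
        countBelow q (toℕ j)                          ≡⟨ countL-addedBefore g (incidentTo v) j ⟨
        countL (incidentTo v) (addedBefore c m g j)   ≡⟨ incid≡countL v (addedBefore c m g j) ⟨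
        incid (g j) (addedBefore c m g j)             <⟨ proj₂ (valid j act′) ⟩
        δ                                             ∎

    newNeighbours-outside : ∀ v → a v ≢ m → countF (λ u → edgeIn v u Mg) ≤ 1
    newNeighbours-outside v av≢m = countF-≤1 _ unique
      where
      neighbour : ∀ u → edgeIn v u Mg ≡ true → ∃[ j ] (c j ≡ v × g j ≡ u × a u ≡ m)
      neighbour u e with addedEdges-∈ g v u e
      ... | j , act , inj₁ (cj≡v , gj≡u) = j , cj≡v , gj≡u , subst (λ w → a w ≡ m) gj≡u (proj₁ (valid j act))
      ... | j , act , inj₂ (_ , refl) = ⊥-elim (av≢m (proj₁ (valid j act)))
      unique : ∀ u₁ u₂ → edgeIn v u₁ Mg ≡ true → edgeIn v u₂ Mg ≡ true → u₁ ≡ u₂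
      unique u₁ u₂ e₁ e₂ with neighbour u₁ e₁ | neighbour u₂ e₂
      ... | j₁ , cj₁≡v , refl , au₁≡m | j₂ , cj₂≡v , refl , au₂≡m
        with repeated-centre j₁ j₂ (trans cj₁≡v (sym cj₂≡v))
      ...   | inj₁ refl = refl
      ...   | inj₂ singleton = trans (singleton u₁ au₁≡m) (sym (singleton u₂ au₂≡m))

    addedEdges-degree : 1 ≤ δ → DegBound G Mg δ
    addedEdges-degree 1≤δ v = begin
      countF (λ u → adj G v u ∨ edgeIn v u Mg)                ≤⟨ countF-∨ (adj G v) (λ u → edgeIn v u Mg) ⟩
      deg (adj G) v + countF (λ u → edgeIn v u Mg)            ≤⟨ +-monoʳ-≤ (deg (adj G) v) new-neighbours ⟩
      deg (adj G) v + δ                                       ∎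
      where
      open ≤-Reasoning
      new-neighbours : countF (λ u → edgeIn v u Mg) ≤ δ
      new-neighbours with a v ≟ m
      ... | yes av≡m = ≤-trans (newNeighbours≤incid v Mg) (incid-largest v av≡m)
      ... | no av≢m = ≤-trans (newNeighbours-outside v av≢m) 1≤δ

  -- choice i is the (i / δ)-th vertex of the largest cluster: each vertex serves δ consecutive centres.
  module Choice (δ : ℕ) .{{_ : NonZero δ}} (largest : LargestCluster a m) (budget : suc k ^ 2 ≤ δ * n) where

    private
      s : ℕ
      s = clusterSize a m

      enough : suc k ≤ s * δ
      enough = *-cancelˡ-≤ (suc k) (begin
        suc k * suc k        ≡⟨ cong (suc k *_) (*-identityʳ (suc k)) ⟨
        suc k ^ 2            ≤⟨ budget ⟩
        δ * n                ≤⟨ *-monoʳ-≤ δ (largestCluster-size a m largest) ⟩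
        δ * (suc k * s)      ≡⟨ trans (*-comm δ (suc k * s)) (*-assoc (suc k) s δ) ⟩
        suc k * (s * δ)      ∎)
        where open ≤-Reasoning

      member : Fin s → Fin n
      member = proj₁ (enumerate (λ v → ⌊ a v ≟ m ⌋))

      member-largest : ∀ r → a (member r) ≡ m
      member-largest r = toWitness≡ (a (member r) ≟ m) (proj₁ (proj₂ (enumerate (λ v → ⌊ a v ≟ m ⌋))) r)

      member-injective : Injective _≡_ _≡_ member
      member-injective = proj₂ (proj₂ (enumerate (λ v → ⌊ a v ≟ m ⌋)))

      block : Fin (suc k) → Fin s
      block i = fromℕ< (m<n*o⇒m/o<n (≤-trans (toℕ<n i) enough))

      toℕ-block : ∀ i → toℕ (block i) ≡ toℕ i / δ
      toℕ-block i = toℕ-fromℕ< _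

    choice : Fin (suc k) → Fin n
    choice i = member (block i)

    private
      choice-largest : ∀ i → a (choice i) ≡ m
      choice-largest i = member-largest (block i)

      same-block : ∀ i j → Active j → incidentTo (choice i) (c j , choice j) ≡ true → toℕ j / δ ≡ toℕ i / δ
      same-block i j act incident with incidentTo-endpoints {v = choice i} {c j} {choice j} incident
      ... | inj₁ cj≡ = ⊥-elim (active-centre-outside act (trans (cong a cj≡) (choice-largest i)))
      ... | inj₂ same = trans (sym (toℕ-block j)) (trans (cong toℕ (member-injective same)) (toℕ-block i))

      earlier-in-block : ∀ i j →
        ⌊ toℕ j <? toℕ i ⌋ ∧ (active? j ∧ incidentTo (choice i) (c j , choice j)) ≡ true →
        (toℕ i / δ) * δ ≤ toℕ j × toℕ j < toℕ i
      earlier-in-block i j e with ∧-true {⌊ toℕ j <? toℕ i ⌋} e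
      ... | j<i , e′ with ∧-true {active? j} e′
      ...   | act , incident =
        subst (λ b → b * δ ≤ toℕ j) (same-block i j (active?-sound act) incident) (m/n*n≤m (toℕ j) δ) ,
        toWitness≡ (toℕ j <? toℕ i) j<i

    choice-valid : ValidChoice c a m δ choice
    choice-valid i _ = choice-largest i , (begin-strict
      incid (choice i) (addedBefore c m choice i)
        ≡⟨ incid≡countL (choice i) (addedBefore c m choice i) ⟩
      countL (incidentTo (choice i)) (addedBefore c m choice i)
        ≡⟨ countL-addedBefore choice (incidentTo (choice i)) i ⟩
      countBelow (λ j → active? j ∧ incidentTo (choice i) (c j , choice j)) (toℕ i)
        ≤⟨ countF-interval _ ((toℕ i / δ) * δ) (toℕ i) (earlier-in-block i) ⟩
      toℕ i ∸ (toℕ i / δ) * δ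
        ≡⟨ m%n≡m∸m/n*n (toℕ i) δ ⟨
      toℕ i % δ
        <⟨ m%n<n (toℕ i) δ ⟩
      δ ∎)
      where open ≤-Reasoning

  module _ {δ : ℕ} {g : Fin (suc k) → Fin n} (valid : ValidChoice c a m δ g)
           {D : ℕ} (near : ∀ w → ∃[ j ] Within (adj G) w (c j) D) where

    private
      G′ : Adj
      G′ = addEdges G (addedEdges c m g)

      lift : ∀ {u v t} → Within (adj G) u v t → Within G′ u v t
      lift = within-mono (λ u v e → ∨-trueˡ _ e)

      G′-sym : SymmetricAdj G′
      G′-sym u v = cong₂ _∨_ (Graph.sym G u v) (edgeIn-sym u v (addedEdges c m g))

      near-own-centre : ∀ u → Within (adj G) u (c (a u)) D
      near-own-centre u = nearest u _ D (proj₂ (near u))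

    reach-largest-centre : ∀ u → Within G′ u (c m) (D + (1 + D))
    reach-largest-centre u with c (a u) ≟ c m
    ... | yes same =
      within-weaken (m≤m+n D (1 + D)) (subst (λ z → Within G′ u z D) same (lift (near-own-centre u)))
    ... | no act = within-trans (lift (near-own-centre u))
                     (within-trans (within-edge (∨-trueʳ _ (addedEdges-∋ g (a u) act))) across)
      where
      across : Within G′ (g (a u)) (c m) D
      across = subst (λ i → Within G′ (g (a u)) (c i) D) (proj₁ (valid (a u) act))
                     (lift (near-own-centre (g (a u))))

    addedEdges-diameter : DiamLe G′ (4 * D + 2)
    addedEdges-diameter u v = within-weaken (≤-reflexive (sym (two-detours D)))
      (within-trans (reach-largest-centre u) (within-sym G′-sym (reach-largest-centre v)))
      where
      two-detours : ∀ D → 4 * D + 2 ≡ (D + (1 + D)) + (D + (1 + D))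
      two-detours = solve 1 (λ D → con 4 :* D :+ con 2 := (D :+ (con 1 :+ D)) :+ (D :+ (con 1 :+ D))) refl
        where open +-*-Solver

lemma2 : (n k δ : ℕ) (G : Graph n) → 1 ≤ δ → 1 ≤ k → suc k ^ 2 ≤ δ * n →
    (c : Fin (suc k) → Fin n) → FarthestFirst G c →
    (a : Fin n → Fin (suc k)) → NearestAssign G c a →
    (m : Fin (suc k)) → LargestCluster a m →
    (∃[ g ] ValidChoice c a m δ g)
    × ((g : Fin (suc k) → Fin n) → ValidChoice c a m δ g →
        length (addedEdges c m g) ≤ k
        × DegBound G (addedEdges c m g) δ
        × ((D : ℕ) → (∃[ M ] (Feasible G k δ M × DiamLe (addEdges G M) D)) →
            DiamLe (addEdges G (addedEdges c m g)) (4 * D + 2)))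
lemma2 n k δ G 1≤δ _ budget c ff a nearest m largest =
  (choice , choice-valid) ,
  λ g valid → addedEdges-length g , addedEdges-degree valid 1≤δ , optimum⇒diameter valid
  where
  open Algorithm G c ff a nearest m
  open Choice δ {{>-nonZero 1≤δ}} largest budget
  optimum⇒diameter : ∀ {g} → ValidChoice c a m δ g → (D : ℕ) →
    ∃[ M ] (Feasible G k δ M × DiamLe (addEdges G M) D) → DiamLe (addEdges G (addedEdges c m g)) (4 * D + 2)
  optimum⇒diameter valid D (M , (_ , |M|≤k , _) , diam) =
    addedEdges-diameter valid
      (farthestFirst-radius G c ff (closePair-of-augmentation M k (adj G) D (Graph.sym G) |M|≤k diam))
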